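{- Let $A$ and $B$ be countable tournaments and let $T=A+B$ be the tournament on $A\sqcup B$ keeping the orientations within $A$ and within $B$ and with $a\to b$ for every $a\in A$, $b\in B$. If $F$ is a finite subtournament of $T$ with $F\cap A\ne\emptyset$ and $z\in B\setminus F$, then $\mathsf{rk}_T(F\cup\{z\})=0$.
   Context: A tournament is a structure $(T,\to)$ with one binary relation such that for every pair of distinct elements $u,v$ exactly one of $u\to v$, $v\to u$ holds (and no $u\to u$). Substructures are induced; $\mathsf{age}(X)$ is the set of finite subtournaments of $X$. If $A'\le B'$ and $|B'\setminus A'|=1$, $B'$ is a prime extension of $A'$. If $A'\le B'$, $A'\le X$, a realization of $B'$ in $X$ is some $C\le X$ with $A'\le C$ and an isomorphism $B'\to C$ fixing $A'$ pointwise. For a countable tournament $X$ and $F\in\mathsf{age}(X)$: $\mathsf{rk}_X(F)\ge 0$ always; $\mathsf{rk}_X(F)\ge\alpha+1$ iff every prime extension of $F$ that is a finite tournament has a realization $C$ in $X$ with $\mathsf{rk}_X(C)\ge\alpha$; for limit $\alpha$, $\mathsf{rk}_X(F)\ge\alpha$ iff $\mathsf{rk}_X(F)\ge\beta$ for all $\beta<\alpha$; $\mathsf{rk}_X(F)=\sup\{\alpha:\mathsf{rk}_X(F)\ge\alpha\}$ (value $\infty$ if unbounded). -}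

module Defs where

open import Data.Nat using (ℕ; zero; suc)
open import Data.Fin using (Fin; zero; suc)
open import Data.List using (List; []; _∷_; length; lookup; tabulate)
open import Data.Sum using (_⊎_; inj₁; inj₂)
open import Data.Product using (Σ; _×_; _,_)
open import Data.Empty using (⊥)
open import Data.Unit using (⊤; tt)
open import Relation.Nullary using (¬_)
open import Relation.Binary.PropositionalEquality using (_≡_; _≢_; refl)
open import Function.Definitions using (Injective)
open import Level using (Lift)

record IsTournament (C : Set) (_⇒_ : C → C → Set) : Set where
  field
    -- at most one of u ⇒ v, v ⇒ u (this also gives irreflexivity)
    asym  : ∀ {u v} → u ⇒ v → ¬ (v ⇒ u)
    total : ∀ u v → u ≢ v → (u ⇒ v) ⊎ (v ⇒ u)

record Tournament : Set₁ where
  field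
    Carrier      : Set
    _⇒_          : Carrier → Carrier → Set
    isTournament : IsTournament Carrier _⇒_

open Tournament public

Countable : Set → Set
Countable C = Σ (C → ℕ) (λ f → Injective _≡_ _≡_ f)

module _ (A B : Tournament) where
  private
    module A = Tournament A
    module B = Tournament B

  SumRel : A.Carrier ⊎ B.Carrier → A.Carrier ⊎ B.Carrier → Set
  SumRel (inj₁ a) (inj₁ a') = a A.⇒ a'
  SumRel (inj₁ a) (inj₂ b)  = ⊤
  SumRel (inj₂ b) (inj₁ a)  = ⊥
  SumRel (inj₂ b) (inj₂ b') = b B.⇒ b'

  private
    sasym : ∀ {u v} → SumRel u v → ¬ SumRel v u
    sasym {inj₁ a} {inj₁ a'} p q = IsTournament.asym A.isTournament p q
    sasym {inj₁ a} {inj₂ b}  p ()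
    sasym {inj₂ b} {inj₁ a}  () q
    sasym {inj₂ b} {inj₂ b'} p q = IsTournament.asym B.isTournament p q

    stotal : ∀ u v → u ≢ v → SumRel u v ⊎ SumRel v u
    stotal (inj₁ a) (inj₁ a') ne = IsTournament.total A.isTournament a a' (λ e → ne (congi e))
      where congi : a ≡ a' → inj₁ a ≡ inj₁ a'
            congi refl = refl
    stotal (inj₁ a) (inj₂ b)  ne = inj₁ tt
    stotal (inj₂ b) (inj₁ a)  ne = inj₂ tt
    stotal (inj₂ b) (inj₂ b') ne = IsTournament.total B.isTournament b b' (λ e → ne (congi e))
      where congi : b ≡ b' → inj₂ b ≡ inj₂ b'
            congi refl = refl

  _⊕_ : Tournament
  _⊕_ = record
    { Carrier      = A.Carrier ⊎ B.Carrier
    ; _⇒_          = SumRel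
    ; isTournament = record { asym = λ {u} {v} → sasym {u} {v} ; total = stotal } }

-- Finite subtournaments of X are given by (duplicate-free) lists of
-- elements of X, with the induced orientation.

module _ (X : Tournament) where
  private module X = Tournament X

  -- A prime extension of F (up to isomorphism over F): a finite tournament
  -- on Fin (1 + |F|), where position (suc i) is the i-th element of F
  -- (orientation agrees with X there) and position zero is the new point.
  record PrimeExt (F : List X.Carrier) : Set₁ where
    field
      rel    : Fin (suc (length F)) → Fin (suc (length F)) → Set
      isTour : IsTournament (Fin (suc (length F))) rel
      agree⇒ : ∀ i j → rel (suc i) (suc j) → lookup F i X.⇒ lookup F j
      agree⇐ : ∀ i j → lookup F i X.⇒ lookup F j → rel (suc i) (suc j)

  record Realization {F : List X.Carrier} (E : PrimeExt F) : Set where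
    field
      emb    : Fin (suc (length F)) → X.Carrier
      inj    : Injective _≡_ _≡_ emb
      pres   : ∀ i j → PrimeExt.rel E i j → emb i X.⇒ emb j
      refl⇒  : ∀ i j → emb i X.⇒ emb j → PrimeExt.rel E i j
      fixes  : ∀ i → emb (suc i) ≡ lookup F i

  image : {F : List X.Carrier} {E : PrimeExt F} → Realization E → List X.Carrier
  image r = tabulate (Realization.emb r)

data Ord : Set where
  ozero : Ord
  osuc  : Ord → Ord
  olim  : (ℕ → Ord) → Ord

RankGe : (X : Tournament) → List (Carrier X) → Ord → Set₁
RankGe X F ozero    = Lift _ ⊤
RankGe X F (osuc α) = (E : PrimeExt X F) → Σ (Realization X E) (λ r → RankGe X (image X r) α)
RankGe X F (olim f) = ∀ n → RankGe X F (f n)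

RankZero : (X : Tournament) → List (Carrier X) → Set₁
RankZero X F = ¬ RankGe X F (osuc ozero)

-- A point of rank ≥ 1 must realise every one-point extension, in particular the
-- one whose new point w satisfies z → w → F. In A + B the arrow z → w forces w
-- into B, while w → a for the point a of F in A forces w into A: no such w exists.
module Submission where

open import Defs
open import Data.Bool using (Bool; true; false; not; T)
open import Data.List using (List; _∷_; length; lookup)
open import Data.List.Membership.Propositional using (_∈_)
open import Data.List.Membership.Propositional.Properties using (∈-lookup)
open import Data.List.Relation.Unary.All as All using ()
open import Data.List.Relation.Unary.All.Properties using (¬Any⇒All¬)
open import Data.List.Relation.Unary.AllPairs using (_∷_)
open import Data.List.Relation.Unary.Any using (index)
open import Data.List.Relation.Unary.Any.Properties using (lookup-index)
open import Data.List.Relation.Unary.Unique.Propositional using (Unique)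
open import Data.Nat using (suc)
open import Data.Fin using (Fin; zero; suc)
open import Data.Empty using (⊥)
open import Data.Product using (∃; _×_; _,_; proj₁)
open import Data.Sum using (_⊎_; inj₁; inj₂)
open import Data.Unit using (tt)
open import Relation.Nullary using (¬_; contradiction)
open import Relation.Binary.PropositionalEquality using (_≡_; _≢_; refl; sym; cong; subst)

lookup-injective : ∀ {A : Set} {xs : List A} → Unique xs →
                   ∀ i j → lookup xs i ≡ lookup xs j → i ≡ j
lookup-injective (_ ∷ _)     zero    zero    _  = refl
lookup-injective (x∉xs ∷ _)  zero    (suc j) eq = contradiction eq (All.lookup x∉xs (∈-lookup j))
lookup-injective (x∉xs ∷ _)  (suc i) zero    eq = contradiction (sym eq) (All.lookup x∉xs (∈-lookup i))
lookup-injective (_ ∷ !xs)   (suc i) (suc j) eq = cong suc (lookup-injective !xs i j eq)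

module _ (X : Tournament) where
  private
    module X = Tournament X
    open IsTournament X.isTournament

  extendBy : {F : List X.Carrier} → Unique F → (Fin (length F) → Bool) → PrimeExt X F
  extendBy {F} !F side = record
    { rel    = rel
    ; isTour = record { asym = λ {u} {v} → rel-asym {u} {v} ; total = rel-total }
    ; agree⇒ = λ _ _ p → p
    ; agree⇐ = λ _ _ p → p
    }
    where
    rel : Fin (suc (length F)) → Fin (suc (length F)) → Set
    rel zero    zero    = ⊥
    rel zero    (suc j) = T (side j)
    rel (suc i) zero    = T (not (side i))
    rel (suc i) (suc j) = lookup F i X.⇒ lookup F j

    rel-asym : ∀ {u v} → rel u v → ¬ rel v u
    rel-asym {zero}  {suc j} p q with side j
    ... | true  = q
    ... | false = p
    rel-asym {suc i} {zero}  p q with side i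
    ... | true  = p
    ... | false = q
    rel-asym {suc i} {suc j} p q = asym p q

    rel-total : ∀ u v → u ≢ v → rel u v ⊎ rel v u
    rel-total zero    zero    u≢v = contradiction refl u≢v
    rel-total zero    (suc j) _   with side j
    ... | true  = inj₁ tt
    ... | false = inj₂ tt
    rel-total (suc i) zero    _   with side i
    ... | true  = inj₂ tt
    ... | false = inj₁ tt
    rel-total (suc i) (suc j) u≢v =
      total _ _ (λ eq → u≢v (cong suc (lookup-injective !F i j eq)))

  module _ {F : List X.Carrier} (!F : Unique F) (side : Fin (length F) → Bool)
           (r : Realization X (extendBy !F side)) where
    open Realization r

    new-⇒ : ∀ i → T (side i) → emb zero X.⇒ lookup F i
    new-⇒ i p = subst (emb zero X.⇒_) (fixes i) (pres zero (suc i) p)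

    ⇒-new : ∀ i → T (not (side i)) → lookup F i X.⇒ emb zero
    ⇒-new i p = subst (X._⇒ emb zero) (fixes i) (pres (suc i) zero p)

  interposed : ∀ {x F} → Unique (x ∷ F) → PrimeExt X (x ∷ F)
  interposed !xF = extendBy !xF λ { zero → false ; (suc _) → true }

  rank≥1⇒interposed : ∀ {x F} (!xF : Unique (x ∷ F)) → RankGe X (x ∷ F) (osuc ozero) →
                      ∃ λ y → x X.⇒ y × (∀ {w} → w ∈ F → y X.⇒ w)
  rank≥1⇒interposed {x} {F} !xF rk≥1 = emb zero , x⇒y , y⇒F
    where
    r : Realization X (interposed !xF)
    r = proj₁ (rk≥1 (interposed !xF))
    open Realization r

    x⇒y : x X.⇒ emb zero
    x⇒y = ⇒-new !xF _ r zero tt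

    y⇒F : ∀ {w} → w ∈ F → emb zero X.⇒ w
    y⇒F w∈F = subst (emb zero X.⇒_) (sym (lookup-index w∈F))
                    (new-⇒ !xF _ r (suc (index w∈F)) tt)

⊕-no-interposed : ∀ (A B : Tournament) {b a} y →
                  SumRel A B (inj₂ b) y → ¬ SumRel A B y (inj₁ a)
⊕-no-interposed A B (inj₂ _) _ ()

lemma5p4 : (A B : Tournament) → Countable (Carrier A) → Countable (Carrier B)
         → (F : List (Carrier (A ⊕ B))) → Unique F
         → ∃ (λ a → inj₁ a ∈ F)
         → (z : Carrier B) → ¬ (inj₂ z ∈ F)
         → RankZero (A ⊕ B) (inj₂ z ∷ F)
lemma5p4 A B _ _ F !F (a , a∈F) z z∉F rk≥1
  with y , z⇒y , y⇒F ← rank≥1⇒interposed (A ⊕ B) (¬Any⇒All¬ F z∉F ∷ !F) rk≥1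
  = ⊕-no-interposed A B y z⇒y (y⇒F a∈F)
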